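{- Let $B$ be a lower Eulerian poset with rank function $\rho_B(x)=\rho(\hat0_B,x)$. Then the map $\sigma:\operatorname{Bary}(B)\to B$ sending a chain $\hat0=x_0<x_1<\cdots<x_k$ to $x_k$ is a strong formal subdivision of rank $0$.
   Context: All posets are finite. Locally graded: in every interval $[x,x']$ all maximal chains have the same length $\rho(x,x')$. Eulerian: min $\hat0$, max $\hat1$, every interval of positive length has as many elements of even as of odd rank; locally Eulerian: every interval Eulerian; lower Eulerian: locally Eulerian with a minimum $\hat0$. $\operatorname{Bary}(B)$ is the set of all chains of $B$ containing $\hat0$, partially ordered by refinement (inclusion of chains), with rank function assigning to a chain the number of its elements different from $\hat0$. A map $\sigma:\Gamma\to B$ between locally Eulerian posets with rank functions $\rho_\Gamma,\rho_B$ is a strong formal subdivision if it is order-preserving, rank-increasing ($\rho_\Gamma(y)\le\rho_B(\sigma(y))$), surjective, and for all $y\in\Gamma$, $x\in B$ with $\sigma(y)\le x$ there exists $y'\ge y$ with $\sigma(y')=x$ and $\rho_\Gamma(y')=\rho_B(x)$, and moreover $\sum_{y'\ge y,\ \sigma(y')=x}(-1)^{\rho_B(x)-\rho_\Gamma(y')}=1$. For lower Eulerian $\Gamma$, $B$, its rank is $\rho_B(\hat0_B)-\rho_\Gamma(\hat0_\Gamma)$. -}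

module Defs where

open import Level using (0ℓ)
open import Data.Bool using (Bool; true; false)
open import Data.Bool.Properties using (T-irrelevant)
open import Data.Nat using (ℕ; zero; suc; _+_)
open import Data.Integer using (ℤ; +_; -_; _-_; ∣_∣) renaming (_≤_ to _≤ℤ_)
open import Data.Fin using (Fin)
open import Data.Fin.Subset using (Subset; _∈_; _⊆_; _─_; ⁅_⁆)
  renaming (∣_∣ to card)
open import Data.Fin.Subset.Properties using (_∈?_; _⊆?_; ⊆-refl; ⊆-trans; ⊆-antisym)
open import Data.Fin.Properties using (decFinSubset)
open import Data.Vec using (Vec; []; _∷_)
open import Data.Vec.Properties using (≡-dec)
open import Data.List using (List; []; _∷_; _++_; map; filter; length; foldr; allFin)
open import Data.List.Membership.Propositional using () renaming (_∈_ to _∈ˡ_)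
open import Data.List.Membership.Propositional.Properties using (∈-allFin; ∈-map⁺; ∈-++⁺ˡ; ∈-++⁺ʳ; ∈-map⁻; ∈-++⁻)
open import Data.List.Relation.Unary.Any using (here; there)
open import Data.List.Relation.Unary.All as All using (All; []; _∷_)
open import Data.List.Relation.Unary.Unique.Propositional using (Unique; []; _∷_)
import Data.List.Relation.Unary.Unique.Propositional.Properties as UP
open import Data.Product using (Σ; Σ-syntax; ∃; ∃-syntax; _×_; _,_; proj₁; proj₂)
open import Data.Sum using (_⊎_; inj₁; inj₂)
open import Data.Empty using (⊥; ⊥-elim)
open import Function using (_∘_)
open import Relation.Nullary using (¬_; Dec; yes; no; _×-dec_; _⊎-dec_)
open import Relation.Nullary.Decidable using (True; fromWitness; toWitness; ⌊_⌋)
open import Relation.Unary using (Pred)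
open import Relation.Binary using (Rel; IsDecPartialOrder; DecidableEquality)
open import Relation.Binary.PropositionalEquality using (_≡_; _≢_; refl; cong; sym; subst)

record Finite (A : Set) : Set where
  field
    enum     : List A
    complete : ∀ a → a ∈ˡ enum
    unique   : Unique enum

record FinPoset : Set₁ where
  field
    Carrier           : Set
    _≤_               : Rel Carrier 0ℓ
    isDecPartialOrder : IsDecPartialOrder _≡_ _≤_
    finite            : Finite Carrier

  open IsDecPartialOrder isDecPartialOrder public
    using (_≟_; _≤?_; reflexive; antisym)
    renaming (refl to ≤-refl; trans to ≤-trans)
  open Finite finite public

  _<_ : Rel Carrier 0ℓ
  x < y = x ≤ y × x ≢ y

  _⋖_ : Rel Carrier 0ℓ
  x ⋖ y = x < y × (∀ z → x < z → z < y → ⊥)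

  count : {P : Pred Carrier 0ℓ} → (∀ z → Dec (P z)) → ℕ
  count P? = length (filter P? enum)

  sumWhere : {P : Pred Carrier 0ℓ} → (∀ z → Dec (P z)) → (Carrier → ℤ) → ℤ
  sumWhere P? f = foldr Data.Integer._+_ (+ 0) (map f (filter P? enum))

  IsMinimum : Carrier → Set
  IsMinimum m = ∀ x → m ≤ x

-- Saturated chains x = z₀ ⋖ z₁ ⋖ ⋯ ⋖ z_k = y of length k.  These are
-- exactly the maximal chains of the interval [x,y].
data MaxChain (P : FinPoset) : FinPoset.Carrier P → FinPoset.Carrier P → ℕ → Set where
  done : ∀ {x} → MaxChain P x x 0
  step : ∀ {x z y k} → FinPoset._⋖_ P x z → MaxChain P z y k → MaxChain P x y (suc k)

LocallyGraded : FinPoset → Set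
LocallyGraded P = ∀ {x y k l} → MaxChain P x y k → MaxChain P x y l → k ≡ l

IsRankFunction : (P : FinPoset) → (FinPoset.Carrier P → ℤ) → Set
IsRankFunction P ρ = ∀ {x y k} → MaxChain P x y k → ρ y ≡ ρ x Data.Integer.+ (+ k)

data Parity : Set where
  even odd : Parity

parity : ℕ → Parity
parity zero = even
parity (suc n) with parity n
... | even = odd
... | odd  = even

_≟ₚ_ : DecidableEquality Parity
even ≟ₚ even = yes refl
even ≟ₚ odd  = no λ ()
odd  ≟ₚ even = no λ ()
odd  ≟ₚ odd  = yes refl

signPow : ℤ → ℤ
signPow k with parity ∣ k ∣
... | even = + 1
... | odd  = - (+ 1)

-- Locally Eulerian posets (with respect to a rank function ρ, so that
-- ρ(x,z) = ρ z - ρ x): locally graded, and every interval [x,y] of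
-- positive length has as many elements z of even rank ρ(x,z) as of odd rank.

module _ (P : FinPoset) (ρ : FinPoset.Carrier P → ℤ) where
  open FinPoset P

  inIntervalOfParity : Carrier → Carrier → Parity → Carrier → Set
  inIntervalOfParity x y p z = x ≤ z × z ≤ y × parity ∣ ρ z - ρ x ∣ ≡ p

  inIntervalOfParity? : ∀ x y p z → Dec (inIntervalOfParity x y p z)
  inIntervalOfParity? x y p z = (x ≤? z) ×-dec (z ≤? y) ×-dec (parity ∣ ρ z - ρ x ∣ ≟ₚ p)

  LocallyEulerian : Set
  LocallyEulerian =
    LocallyGraded P ×
    (∀ x y → x < y →
      count (inIntervalOfParity? x y even) ≡ count (inIntervalOfParity? x y odd))

  LowerEulerian : Set
  LowerEulerian = LocallyEulerian × Σ Carrier IsMinimum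

module _ (Γ B : FinPoset) (ρΓ : FinPoset.Carrier Γ → ℤ) (ρB : FinPoset.Carrier B → ℤ)
         (σ : FinPoset.Carrier Γ → FinPoset.Carrier B) where
  private
    module G = FinPoset Γ
    module Bp = FinPoset B

  fiberAbove? : (y : G.Carrier) (x : Bp.Carrier) → ∀ y' → Dec (y G.≤ y' × σ y' ≡ x)
  fiberAbove? y x y' = (y G.≤? y') ×-dec (σ y' Bp.≟ x)

  IsStrongFormalSubdivision : Set
  IsStrongFormalSubdivision =
    (LocallyEulerian Γ ρΓ × IsRankFunction Γ ρΓ) ×
    (LocallyEulerian B ρB × IsRankFunction B ρB) ×
    (∀ y y' → y G.≤ y' → σ y Bp.≤ σ y') ×
    (∀ y → ρΓ y ≤ℤ ρB (σ y)) ×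
    (∀ x → ∃[ y ] σ y ≡ x) ×
    (∀ y x → σ y Bp.≤ x →
       (∃[ y' ] (y G.≤ y' × σ y' ≡ x × ρΓ y' ≡ ρB x)) ×
       G.sumWhere (fiberAbove? y x) (λ y' → signPow (ρB x - ρΓ y')) ≡ + 1)

  IsStrongFormalSubdivisionOfRank : ℤ → Set
  IsStrongFormalSubdivisionOfRank r =
    IsStrongFormalSubdivision ×
    LowerEulerian Γ ρΓ × LowerEulerian B ρB ×
    (∀ 0Γ 0B → G.IsMinimum 0Γ → Bp.IsMinimum 0B → ρB 0B - ρΓ 0Γ ≡ r)

-- Finite posets whose underlying set is Fin n (every finite poset is
-- isomorphic to one of these).

record FinOrder (n : ℕ) : Set₁ where
  field
    _≤_               : Rel (Fin n) 0ℓ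
    isDecPartialOrder : IsDecPartialOrder _≡_ _≤_

finiteFin : ∀ n → Finite (Fin n)
finiteFin n = record { enum = allFin n ; complete = ∈-allFin ; unique = UP.allFin⁺ n }

toFinPoset : ∀ {n} → FinOrder n → FinPoset
toFinPoset {n} B = record
  { Carrier = Fin n
  ; _≤_ = FinOrder._≤_ B
  ; isDecPartialOrder = FinOrder.isDecPartialOrder B
  ; finite = finiteFin n
  }

allSubsets : ∀ n → List (Subset n)
allSubsets zero    = [] ∷ []
allSubsets (suc n) = map (false ∷_) (allSubsets n) ++ map (true ∷_) (allSubsets n)

allSubsets-complete : ∀ {n} (S : Subset n) → S ∈ˡ allSubsets n
allSubsets-complete []          = here refl
allSubsets-complete {suc n} (false ∷ S) = ∈-++⁺ˡ (∈-map⁺ (false ∷_) (allSubsets-complete S))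
allSubsets-complete {suc n} (true ∷ S)  =
  ∈-++⁺ʳ (map (false ∷_) (allSubsets n)) (∈-map⁺ (true ∷_) (allSubsets-complete S))

private
  ∷-injʳ : ∀ {n} {b} {S S' : Subset n} → Data.Vec._∷_ b S ≡ b ∷ S' → S ≡ S'
  ∷-injʳ refl = refl

allSubsets-unique : ∀ n → Unique (allSubsets n)
allSubsets-unique zero    = [] ∷ []
allSubsets-unique (suc n) =
  UP.++⁺ (UP.map⁺ ∷-injʳ (allSubsets-unique n)) (UP.map⁺ ∷-injʳ (allSubsets-unique n)) disj
  where
  disj : ∀ {v} → v ∈ˡ map (false ∷_) (allSubsets n) × v ∈ˡ map (true ∷_) (allSubsets n) → ⊥
  disj (p , q) with ∈-map⁻ (false ∷_) p | ∈-map⁻ (true ∷_) q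
  ... | _ , _ , refl | _ , _ , ()

finiteSubset : ∀ n → Finite (Subset n)
finiteSubset n = record
  { enum = allSubsets n ; complete = allSubsets-complete ; unique = allSubsets-unique n }

module _ {A : Set} {P : Pred A 0ℓ} (P? : ∀ a → Dec (P a)) where

  Sub : Set
  Sub = Σ A (λ a → True (P? a))

  Sub-≡ : {c c' : Sub} → proj₁ c ≡ proj₁ c' → c ≡ c'
  Sub-≡ {a , p} {.a , q} refl = cong (a ,_) (T-irrelevant p q)

  subList : List A → List Sub
  subList [] = []
  subList (a ∷ as) with P? a
  ... | yes p = (a , fromWitness p) ∷ subList as
  ... | no _  = subList as

  subList-∈ : ∀ {c} as → c ∈ˡ subList as → proj₁ c ∈ˡ as
  subList-∈ (a ∷ as) m with P? a
  subList-∈ (a ∷ as) (here refl) | yes p = here refl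
  subList-∈ (a ∷ as) (there m)   | yes p = there (subList-∈ as m)
  ... | no _ = there (subList-∈ as m)

  subList-complete : ∀ (c : Sub) as → proj₁ c ∈ˡ as → c ∈ˡ subList as
  subList-complete c (a ∷ as) m with P? a | m
  ... | yes p | here refl = here (Sub-≡ refl)
  ... | yes p | there m'  = there (subList-complete c as m')
  ... | no ¬p | here refl = ⊥-elim (¬p (toWitness (proj₂ c)))
  ... | no ¬p | there m'  = subList-complete c as m'

  subList-unique : ∀ as → Unique as → Unique (subList as)
  subList-unique [] u = []
  subList-unique (a ∷ as) (a∉ ∷ u) with P? a
  ... | yes p = All.tabulate (λ {c} m eq → All.lookup a∉ (subList-∈ as m) (cong proj₁ eq))
                ∷ subList-unique as u
  ... | no _  = subList-unique as u

  finiteSub : Finite A → Finite Sub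
  finiteSub F = record
    { enum = subList (Finite.enum F)
    ; complete = λ c → subList-complete c (Finite.enum F) (Finite.complete F (proj₁ c))
    ; unique = subList-unique (Finite.enum F) (Finite.unique F)
    }

-- The barycentric subdivision Bary(B): chains of B containing 0̂,
-- ordered by refinement (inclusion), ranked by the number of elements ≠ 0̂.

module _ {n : ℕ} (B : FinOrder n) where
  open FinOrder B
  open IsDecPartialOrder isDecPartialOrder using (_≤?_)

  IsChain : Subset n → Set
  IsChain S = ∀ {i} → i ∈ S → ∀ {j} → j ∈ S → (i ≤ j ⊎ j ≤ i)

  IsChain? : ∀ S → Dec (IsChain S)
  IsChain? S = decFinSubset (_∈? S) (λ {i} _ →
               decFinSubset (_∈? S) (λ {j} _ → (i ≤? j) ⊎-dec (j ≤? i)))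

  module _ (0̂ : Fin n) where

    IsChainWith0 : Subset n → Set
    IsChainWith0 S = 0̂ ∈ S × IsChain S

    IsChainWith0? : ∀ S → Dec (IsChainWith0 S)
    IsChainWith0? S = (0̂ ∈? S) ×-dec IsChain? S

    BaryCarrier : Set
    BaryCarrier = Sub IsChainWith0?

    chain : BaryCarrier → Subset n
    chain = proj₁

    _≤ᴮ_ : Rel BaryCarrier 0ℓ
    c ≤ᴮ c' = chain c ⊆ chain c'

    private
      ≟ᴮ : DecidableEquality BaryCarrier
      ≟ᴮ c c' with ≡-dec Data.Bool._≟_ (chain c) (chain c')
      ... | yes e = yes (Sub-≡ IsChainWith0? e)
      ... | no ne = no (λ e → ne (cong proj₁ e))

      isDPO : IsDecPartialOrder _≡_ _≤ᴮ_
      isDPO = record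
        { isPartialOrder = record
          { isPreorder = record
            { isEquivalence = Relation.Binary.PropositionalEquality.isEquivalence
            ; reflexive = λ { refl → ⊆-refl }
            ; trans = ⊆-trans
            }
          ; antisym = λ p q → Sub-≡ IsChainWith0? (⊆-antisym p q)
          }
        ; _≟_ = ≟ᴮ
        ; _≤?_ = λ c c' → chain c ⊆? chain c'
        }

    Bary : FinPoset
    Bary = record
      { Carrier = BaryCarrier
      ; _≤_ = _≤ᴮ_
      ; isDecPartialOrder = isDPO
      ; finite = finiteSub IsChainWith0? (finiteSubset n)
      }

    rankBary : BaryCarrier → ℕ
    rankBary c = card (chain c ─ ⁅ 0̂ ⁆)

module Submission where

-- An interval [c, c′] of Bary(B) is the Boolean lattice of sets between the chains c ⊆ c′,
-- ranked by cardinality; toggling a fixed element of c′ ∖ c reverses signs, so Bary(B) is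
-- locally Eulerian.  For the fibres, let χ x c = Σ (-1)^|S| over the chains S ⊇ c (containing 0̂)
-- whose top is x.  Toggling x matches these S with the chains S′ ⊇ c ∖ {x} lying strictly below
-- x; grouping the S′ by their top m, which ranges over [s, x) for s the top of c ∖ {x}, and
-- inducting on x gives χ x c = Σ_{s ≤ m < x} (-1)^ρ(m) = -(-1)^ρ(x), because the interval
-- [s, x] of B is Eulerian.  The signed fibre sum is then (-1)^ρ(x) · (-χ x c) = 1.  The
-- same induction, run along a cover m ⋖ x, yields a fibre element of full rank ρ(x).

open import Defs
open import Data.Bool as Bool using (true; false; not; if_then_else_)
open import Data.Bool.Properties using (not-involutive)
open import Data.Empty using (⊥-elim)
open import Function using (_∘_; flip)
open import Data.Fin using (Fin; zero; suc)
open import Data.Fin.Subset using (Subset; _∈_; _∉_; _⊆_; _⊂_; _─_; ⁅_⁆) renaming (∣_∣ to card)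
open import Data.Fin.Subset.Properties
  using (_∈?_; _⊆?_; ⊆-antisym; p─⊥≡p; p─q⊆p; x∈p∧x≢y⇒x∈p-y; p⊆q⇒∣p∣≤∣q∣; x∈⁅x⁆; x∈⁅y⁆⇒x≡y; ∣⁅x⁆∣≡1)
import Data.Fin.Properties as Finₚ
open import Data.Fin.Properties using (any?; decFinSubset)
open import Data.Vec using (_∷_; here; there; _[_]%=_)
open import Data.Vec.Properties using (≡-dec)
open import Data.Integer as ℤ
  using (ℤ; +_; -[1+_]; -_; _+_; _-_; _*_; _⊖_; 0ℤ; 1ℤ; ∣_∣) renaming (_≤_ to _≤ℤ_)
import Data.Integer.Properties as ℤₚ
open import Algebra.Properties.CommutativeSemigroup ℤₚ.+-commutativeSemigroup
  using () renaming (interchange to +-interchange)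
open import Data.List using (List; []; _∷_; _++_; map; filter; foldr; length)
open import Data.List.Membership.Propositional using () renaming (_∈_ to _∈ˡ_; _∉_ to _∉ˡ_)
open import Data.List.Relation.Unary.All as All using ()
open import Data.List.Relation.Unary.Any using (here; there)
open import Data.List.Relation.Unary.Unique.Propositional using (Unique; _∷_)
open import Data.Nat as ℕ using (ℕ; zero; suc)
import Data.Nat.Properties as ℕₚ
open import Data.Product using (∃-syntax; _×_; _,_; proj₁; proj₂)
open import Data.Sum using (_⊎_; inj₁; inj₂)
open import Level using (0ℓ)
open import Relation.Binary using (DecidableEquality; IsDecPartialOrder)
open import Induction.WellFounded using (Acc; acc; WellFounded)
open import Data.Fin.Induction using (po-wellFounded; po-noetherian)
open import Relation.Binary.PropositionalEquality
  using (_≡_; _≢_; refl; sym; trans; cong; cong₂; subst; module ≡-Reasoning)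
open import Relation.Nullary using (¬_; ¬?; Dec; yes; no; does; _×-dec_; contradiction)
open import Relation.Nullary.Decidable using (fromWitness; toWitness; decidable-stable)
open import Relation.Unary using (Pred; Decidable)


private variable
  A A′ P Q : Set
  n : ℕ

∑ : List A → (A → ℤ) → ℤ
∑ xs f = foldr _+_ 0ℤ (map f xs)

∑-cong : ∀ xs {f g : A → ℤ} → (∀ a → f a ≡ g a) → ∑ xs f ≡ ∑ xs g
∑-cong []       f≗g = refl
∑-cong (a ∷ xs) f≗g = cong₂ _+_ (f≗g a) (∑-cong xs f≗g)

∑-zero : ∀ xs → ∑ xs (λ (_ : A) → 0ℤ) ≡ 0ℤ
∑-zero []       = refl
∑-zero (a ∷ xs) = trans (ℤₚ.+-identityˡ _) (∑-zero xs)

∑-distrib-+ : ∀ xs (f g : A → ℤ) → ∑ xs (λ a → f a + g a) ≡ ∑ xs f + ∑ xs g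
∑-distrib-+ []       f g = refl
∑-distrib-+ (a ∷ xs) f g =
  trans (cong (λ t → (f a + g a) + t) (∑-distrib-+ xs f g)) (+-interchange (f a) (g a) _ _)

∑-distribˡ-* : ∀ xs c (f : A → ℤ) → ∑ xs (λ a → c * f a) ≡ c * ∑ xs f
∑-distribˡ-* []       c f = sym (ℤₚ.*-zeroʳ c)
∑-distribˡ-* (a ∷ xs) c f =
  trans (cong (λ t → c * f a + t) (∑-distribˡ-* xs c f)) (sym (ℤₚ.*-distribˡ-+ c (f a) _))

∑-neg : ∀ xs (f : A → ℤ) → ∑ xs (λ a → - f a) ≡ - ∑ xs f
∑-neg []       f = refl
∑-neg (a ∷ xs) f = trans (cong (λ t → - f a + t) (∑-neg xs f)) (sym (ℤₚ.neg-distrib-+ (f a) _))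

∑-++ : ∀ xs ys (f : A → ℤ) → ∑ (xs ++ ys) f ≡ ∑ xs f + ∑ ys f
∑-++ []       ys f = sym (ℤₚ.+-identityˡ _)
∑-++ (a ∷ xs) ys f = trans (cong (λ t → f a + t) (∑-++ xs ys f)) (sym (ℤₚ.+-assoc (f a) _ _))

∑-map : ∀ (g : A′ → A) xs (f : A → ℤ) → ∑ (map g xs) f ≡ ∑ xs (λ b → f (g b))
∑-map g []       f = refl
∑-map g (b ∷ xs) f = cong (λ t → f (g b) + t) (∑-map g xs f)

∑-comm : ∀ xs (ys : List A′) (f : A → A′ → ℤ) →
         ∑ xs (λ a → ∑ ys (f a)) ≡ ∑ ys (λ b → ∑ xs (λ a → f a b))
∑-comm []       ys f = sym (∑-zero ys)
∑-comm (a ∷ xs) ys f = trans (cong (λ t → ∑ ys (f a) + t) (∑-comm xs ys f))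
                             (sym (∑-distrib-+ ys (f a) _))

when : Dec P → ℤ → ℤ
when P? v = if does P? then v else 0ℤ

when-yes : ∀ (P? : Dec P) {v} → P → when P? v ≡ v
when-yes (yes _) p = refl
when-yes (no ¬p) p = ⊥-elim (¬p p)

when-no : ∀ (P? : Dec P) {v} → ¬ P → when P? v ≡ 0ℤ
when-no (yes p) ¬p = ⊥-elim (¬p p)
when-no (no _)  ¬p = refl

when-≡ : ∀ (P? : Dec P) {v r} → (P → v ≡ r) → (¬ P → 0ℤ ≡ r) → when P? v ≡ r
when-≡ (yes p) v≡r _    = v≡r p
when-≡ (no ¬p) _   0≡r = 0≡r ¬p

when-cong : ∀ (P? : Dec P) (Q? : Dec Q) {v} → (P → Q) → (Q → P) → when P? v ≡ when Q? v
when-cong P? (yes q) _ Q→P = when-yes P? (Q→P q)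
when-cong P? (no ¬q) P→Q Q→P = when-no P? (λ p → ¬q (P→Q p))

when-congʳ : ∀ (P? : Dec P) {v w} → (P → v ≡ w) → when P? v ≡ when P? w
when-congʳ (yes p) v≡w = v≡w p
when-congʳ (no _)  v≡w = refl

when-× : ∀ (P? : Dec P) (Q? : Dec Q) v → when (P? ×-dec Q?) v ≡ when P? (when Q? v)
when-× (yes _) Q? v = refl
when-× (no _)  Q? v = refl

when-0 : ∀ (P? : Dec P) → when P? 0ℤ ≡ 0ℤ
when-0 (yes _) = refl
when-0 (no _)  = refl

when-neg : ∀ (P? : Dec P) v → when P? (- v) ≡ - when P? v
when-neg (yes _) v = refl
when-neg (no _)  v = refl

when-*ˡ : ∀ (P? : Dec P) c v → when P? (c * v) ≡ c * when P? v
when-*ˡ (yes _) c v = refl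
when-*ˡ (no _)  c v = sym (ℤₚ.*-zeroʳ c)

∑-when : ∀ (P? : Dec P) xs (f : A → ℤ) → ∑ xs (λ a → when P? (f a)) ≡ when P? (∑ xs f)
∑-when (yes _) xs f = refl
∑-when (no _)  xs f = ∑-zero xs

module _ {P : Pred A 0ℓ} (P? : Decidable P) where

  ∑-filter : ∀ xs (f : A → ℤ) → ∑ (filter P? xs) f ≡ ∑ xs (λ a → when (P? a) (f a))
  ∑-filter []       f = refl
  ∑-filter (a ∷ xs) f with does (P? a)
  ... | true  = cong (λ t → f a + t) (∑-filter xs f)
  ... | false = trans (∑-filter xs f) (sym (ℤₚ.+-identityˡ _))

  length-filter : ∀ xs → + length (filter P? xs) ≡ ∑ xs (λ a → when (P? a) 1ℤ)
  length-filter []       = refl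
  length-filter (a ∷ xs) with does (P? a)
  ... | true  = trans (ℤₚ.pos-+ 1 _) (cong (λ t → 1ℤ + t) (length-filter xs))
  ... | false = trans (length-filter xs) (sym (ℤₚ.+-identityˡ _))

  ∑-subList : ∀ (g : Sub P? → ℤ) (f : A → ℤ) →
              (∀ a (p : P a) → g (a , fromWitness p) ≡ f a) → (∀ a → ¬ P a → f a ≡ 0ℤ) →
              ∀ xs → ∑ (subList P? xs) g ≡ ∑ xs f
  ∑-subList g f g≡f f≡0 []       = refl
  ∑-subList g f g≡f f≡0 (a ∷ xs) with P? a
  ... | yes p = cong₂ _+_ (g≡f a p) (∑-subList g f g≡f f≡0 xs)
  ... | no ¬p = begin
    ∑ (subList P? xs) g ≡⟨ ∑-subList g f g≡f f≡0 xs ⟩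
    ∑ xs f              ≡⟨ ℤₚ.+-identityˡ _ ⟨
    0ℤ + ∑ xs f         ≡⟨ cong (_+ ∑ xs f) (f≡0 a ¬p) ⟨
    f a + ∑ xs f        ∎
    where open ≡-Reasoning

module _ (_≟_ : DecidableEquality A) (f : A → ℤ) where

  ∑-δ-∉ : ∀ {t} xs → t ∉ˡ xs → ∑ xs (λ a → when (a ≟ t) (f a)) ≡ 0ℤ
  ∑-δ-∉     []       t∉xs = refl
  ∑-δ-∉ {t} (a ∷ xs) t∉xs =
    cong₂ _+_ (when-no (a ≟ t) {f a} λ { refl → t∉xs (here refl) }) (∑-δ-∉ xs (t∉xs ∘ there))

  ∑-δ : ∀ {t} xs → Unique xs → t ∈ˡ xs → ∑ xs (λ a → when (a ≟ t) (f a)) ≡ f t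
  ∑-δ {t} (a ∷ xs) (a∉xs ∷ u) t∈a∷xs with a ≟ t
  ... | yes refl = trans (cong (λ s → f a + s) (∑-δ-∉ xs λ a∈xs → All.lookup a∉xs a∈xs refl))
                         (ℤₚ.+-identityʳ _)
  ... | no a≢t with t∈a∷xs
  ...   | here t≡a    = ⊥-elim (a≢t (sym t≡a))
  ...   | there t∈xs = trans (ℤₚ.+-identityˡ _) (∑-δ xs u t∈xs)

sg : ℕ → ℤ
sg k = signPow (+ k)

sg-suc : ∀ k → sg (suc k) ≡ - sg k
sg-suc k with parity k
... | even = refl
... | odd  = refl

sg*sg≡1 : ∀ k → sg k * sg k ≡ 1ℤ
sg*sg≡1 k with parity k
... | even = refl
... | odd  = refl

sg*i≡0⇒i≡0 : ∀ k {i} → sg k * i ≡ 0ℤ → i ≡ 0ℤ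
sg*i≡0⇒i≡0 k sg*i≡0 with ℤₚ.i*j≡0⇒i≡0∨j≡0 (sg k) sg*i≡0
... | inj₂ i≡0  = i≡0
... | inj₁ sg≡0 with parity k
...   | even = contradiction sg≡0 λ ()
...   | odd  = contradiction sg≡0 λ ()

signPow-abs : ∀ i → signPow i ≡ sg ∣ i ∣
signPow-abs i with parity ∣ i ∣
... | even = refl
... | odd  = refl

signPow≡even-odd : ∀ i → signPow i ≡ when (parity ∣ i ∣ ≟ₚ even) 1ℤ - when (parity ∣ i ∣ ≟ₚ odd) 1ℤ
signPow≡even-odd i with parity ∣ i ∣
... | even = refl
... | odd  = refl

signPow-diff : ∀ a b → signPow (+ a - + b) ≡ sg a * sg b
signPow-diff a       zero    = trans (cong signPow (ℤₚ.+-identityʳ (+ a))) (sym (ℤₚ.*-identityʳ (sg a)))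
signPow-diff zero    (suc b) = trans (signPow-abs -[1+ b ]) (sym (ℤₚ.*-identityˡ (sg (suc b))))
signPow-diff (suc a) (suc b) = begin
  signPow (+ suc a - + suc b) ≡⟨ cong signPow (ℤₚ.[+m]-[+n]≡m⊖n (suc a) (suc b)) ⟩
  signPow (suc a ⊖ suc b)     ≡⟨ cong signPow (ℤₚ.[1+m]⊖[1+n]≡m⊖n a b) ⟩
  signPow (a ⊖ b)             ≡⟨ cong signPow (ℤₚ.[+m]-[+n]≡m⊖n a b) ⟨
  signPow (+ a - + b)         ≡⟨ signPow-diff a b ⟩
  sg a * sg b                 ≡⟨ sg-suc-suc ⟨
  sg (suc a) * sg (suc b)     ∎
  where
  open ≡-Reasoning
  sg-suc-suc : sg (suc a) * sg (suc b) ≡ sg a * sg b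
  sg-suc-suc with parity a | parity b
  ... | even | even = refl
  ... | even | odd  = refl
  ... | odd  | even = refl
  ... | odd  | odd  = refl

signPow-diff-comm : ∀ a b → signPow (+ a - + b) ≡ signPow (+ b - + a)
signPow-diff-comm a b =
  trans (signPow-diff a b) (trans (ℤₚ.*-comm (sg a) (sg b)) (sym (signPow-diff b a)))

i≡-i⇒i≡0 : ∀ {i} → i ≡ - i → i ≡ 0ℤ
i≡-i⇒i≡0 {+ zero}   _  = refl
i≡-i⇒i≡0 {+ suc _}  ()
i≡-i⇒i≡0 { -[1+ _ ]} ()

toggle : Fin n → Subset n → Subset n
toggle x S = S [ x ]%= not

toggle-involutive : ∀ (x : Fin n) S → toggle x (toggle x S) ≡ S
toggle-involutive zero    (b ∷ S) = cong (_∷ S) (not-involutive b)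
toggle-involutive (suc x) (b ∷ S) = cong (b ∷_) (toggle-involutive x S)

x∈toggle : ∀ {x : Fin n} {S} → x ∉ S → x ∈ toggle x S
x∈toggle {x = zero}  {S = false ∷ S} _    = here
x∈toggle {x = zero}  {S = true ∷ S}  x∉S  = ⊥-elim (x∉S here)
x∈toggle {x = suc x} {S = b ∷ S}     x∉S  = there (x∈toggle (x∉S ∘ there))

x∉toggle : ∀ {x : Fin n} {S} → x ∈ S → x ∉ toggle x S
x∉toggle {x = zero}  here        ()
x∉toggle {x = suc x} (there x∈S) (there x∈tS) = x∉toggle x∈S x∈tS

y∈toggle : ∀ {x y : Fin n} {S} → y ≢ x → y ∈ S → y ∈ toggle x S
y∈toggle {x = zero}  {y = zero}  y≢x _           = ⊥-elim (y≢x refl)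
y∈toggle {x = zero}  {y = suc y} y≢x (there y∈S) = there y∈S
y∈toggle {x = suc x} {y = zero}  y≢x here        = here
y∈toggle {x = suc x} {y = suc y} y≢x (there y∈S) = there (y∈toggle (y≢x ∘ cong suc) y∈S)

y∈toggle⁻ : ∀ {x y : Fin n} {S} → y ≢ x → y ∈ toggle x S → y ∈ S
y∈toggle⁻ {x = x} {S = S} y≢x y∈tS = subst (_ ∈_) (toggle-involutive x S) (y∈toggle y≢x y∈tS)

∈toggle⇒≡⊎∈ : ∀ {x y : Fin n} {S} → y ∈ toggle x S → y ≡ x ⊎ y ∈ S
∈toggle⇒≡⊎∈ {x = x} {y} y∈tS with y Finₚ.≟ x
... | yes y≡x = inj₁ y≡x
... | no y≢x  = inj₂ (y∈toggle⁻ y≢x y∈tS)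

card-toggle-∉ : ∀ {x : Fin n} {S} → x ∉ S → card (toggle x S) ≡ suc (card S)
card-toggle-∉ {x = zero}  {S = false ∷ S} _   = refl
card-toggle-∉ {x = zero}  {S = true ∷ S}  x∉S = ⊥-elim (x∉S here)
card-toggle-∉ {x = suc x} {S = false ∷ S} x∉S = card-toggle-∉ (x∉S ∘ there)
card-toggle-∉ {x = suc x} {S = true ∷ S}  x∉S = cong suc (card-toggle-∉ (x∉S ∘ there))

sg-card-toggle : ∀ (x : Fin n) S → sg (card (toggle x S)) ≡ - sg (card S)
sg-card-toggle x S with x ∈? S
... | no x∉S  = trans (cong sg (card-toggle-∉ x∉S)) (sg-suc (card S))
... | yes x∈S = begin
  sg (card (toggle x S))             ≡⟨ ℤₚ.neg-involutive _ ⟨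
  - - sg (card (toggle x S))         ≡⟨ cong -_ (sg-suc (card (toggle x S))) ⟨
  - sg (suc (card (toggle x S)))     ≡⟨ cong (-_ ∘ sg) (card-toggle-∉ (x∉toggle x∈S)) ⟨
  - sg (card (toggle x (toggle x S))) ≡⟨ cong (-_ ∘ sg ∘ card) (toggle-involutive x S) ⟩
  - sg (card S)                      ∎
  where open ≡-Reasoning

x∉S─⁅x⁆ : ∀ {x : Fin n} {S} → x ∉ S ─ ⁅ x ⁆
x∉S─⁅x⁆ {x = zero}  {S = b ∷ S} ()
x∉S─⁅x⁆ {x = suc x} {S = b ∷ S} (there x∈S─x) = x∉S─⁅x⁆ x∈S─x

∈─⁅x⁆⇒≢x : ∀ {x y : Fin n} {S} → y ∈ S ─ ⁅ x ⁆ → y ≢ x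
∈─⁅x⁆⇒≢x y∈S─x refl = x∉S─⁅x⁆ y∈S─x

card-─⁅⁆ : ∀ {x : Fin n} {S} → x ∈ S → card S ≡ suc (card (S ─ ⁅ x ⁆))
card-─⁅⁆ {x = zero}  {S = true ∷ S}  here        = cong (suc ∘ card) (sym (p─⊥≡p S))
card-─⁅⁆ {x = suc x} {S = false ∷ S} (there x∈S) = card-─⁅⁆ x∈S
card-─⁅⁆ {x = suc x} {S = true ∷ S}  (there x∈S) = cong suc (card-─⁅⁆ x∈S)

∑-allSubsets-suc : ∀ (f : Subset (suc n) → ℤ) →
  ∑ (allSubsets (suc n)) f ≡ ∑ (allSubsets n) (f ∘ (false ∷_)) + ∑ (allSubsets n) (f ∘ (true ∷_))
∑-allSubsets-suc {n} f =
  trans (∑-++ (map (false ∷_) (allSubsets n)) _ f)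
        (cong₂ _+_ (∑-map (false ∷_) (allSubsets n) f) (∑-map (true ∷_) (allSubsets n) f))

∑-toggle : ∀ (x : Fin n) (f : Subset n → ℤ) → ∑ (allSubsets n) (f ∘ toggle x) ≡ ∑ (allSubsets n) f
∑-toggle {suc n} zero f = begin
  ∑ (allSubsets (suc n)) (f ∘ toggle zero)
    ≡⟨ ∑-allSubsets-suc (f ∘ toggle zero) ⟩
  ∑ (allSubsets n) (f ∘ (true ∷_)) + ∑ (allSubsets n) (f ∘ (false ∷_))
    ≡⟨ ℤₚ.+-comm (∑ (allSubsets n) (f ∘ (true ∷_))) _ ⟩
  ∑ (allSubsets n) (f ∘ (false ∷_)) + ∑ (allSubsets n) (f ∘ (true ∷_))
    ≡⟨ ∑-allSubsets-suc f ⟨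
  ∑ (allSubsets (suc n)) f ∎
  where open ≡-Reasoning
∑-toggle {suc n} (suc x) f = begin
  ∑ (allSubsets (suc n)) (f ∘ toggle (suc x))
    ≡⟨ ∑-allSubsets-suc (f ∘ toggle (suc x)) ⟩
  ∑ (allSubsets n) (f ∘ (false ∷_) ∘ toggle x) + ∑ (allSubsets n) (f ∘ (true ∷_) ∘ toggle x)
    ≡⟨ cong₂ _+_ (∑-toggle x (f ∘ (false ∷_))) (∑-toggle x (f ∘ (true ∷_))) ⟩
  ∑ (allSubsets n) (f ∘ (false ∷_)) + ∑ (allSubsets n) (f ∘ (true ∷_))
    ≡⟨ ∑-allSubsets-suc f ⟨
  ∑ (allSubsets (suc n)) f ∎
  where open ≡-Reasoning

⊆∧≢⇒⊂ : ∀ {S T : Subset n} → S ⊆ T → S ≢ T → S ⊂ T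
⊆∧≢⇒⊂ {S = S} {T} S⊆T S≢T with any? (λ e → (e ∈? T) ×-dec ¬? (e ∈? S))
... | yes e∈T∖S = S⊆T , e∈T∖S
... | no ∄e     = ⊥-elim (S≢T (⊆-antisym S⊆T T⊆S))
  where
  T⊆S : T ⊆ S
  T⊆S {e} e∈T = decidable-stable (e ∈? S) (λ e∉S → ∄e (e , e∈T , e∉S))

⊆-toggle : ∀ {e : Fin n} {S U} → e ∉ S → S ⊆ U → S ⊆ toggle e U
⊆-toggle e∉S S⊆U j∈S = y∈toggle (λ { refl → e∉S j∈S }) (S⊆U j∈S)

toggle-⊆ : ∀ {e : Fin n} {T U} → e ∈ T → U ⊆ T → toggle e U ⊆ T
toggle-⊆ e∈T U⊆T j∈tU with ∈toggle⇒≡⊎∈ j∈tU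
... | inj₁ refl = e∈T
... | inj₂ j∈U  = U⊆T j∈U

module _ {e : Fin n} {S T : Subset n} (e∉S : e ∉ S) (e∈T : e ∈ T) where

  toggle-interval : ∀ U → S ⊆ U × U ⊆ T → S ⊆ toggle e U × toggle e U ⊆ T
  toggle-interval U (S⊆U , U⊆T) = ⊆-toggle e∉S S⊆U , toggle-⊆ e∈T U⊆T

  toggle-interval⁻ : ∀ U → S ⊆ toggle e U × toggle e U ⊆ T → S ⊆ U × U ⊆ T
  toggle-interval⁻ U = subst (λ V → S ⊆ V × V ⊆ T) (toggle-involutive e U) ∘ toggle-interval (toggle e U)

  ∑-sg-card-interval : ∑ (allSubsets n) (λ U → when (S ⊆? U ×-dec U ⊆? T) (sg (card U))) ≡ 0ℤ
  ∑-sg-card-interval = i≡-i⇒i≡0 (begin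
    ∑ (allSubsets n) F                ≡⟨ ∑-toggle e F ⟨
    ∑ (allSubsets n) (F ∘ toggle e)   ≡⟨ ∑-cong (allSubsets n) F∘toggle≡-F ⟩
    ∑ (allSubsets n) (λ U → - F U)    ≡⟨ ∑-neg (allSubsets n) F ⟩
    - ∑ (allSubsets n) F              ∎)
    where
    open ≡-Reasoning
    F : Subset n → ℤ
    F U = when (S ⊆? U ×-dec U ⊆? T) (sg (card U))
    F∘toggle≡-F : ∀ U → F (toggle e U) ≡ - F U
    F∘toggle≡-F U = begin
      F (toggle e U)
        ≡⟨ cong (when (S ⊆? toggle e U ×-dec toggle e U ⊆? T)) (sg-card-toggle e U) ⟩
      when (S ⊆? toggle e U ×-dec toggle e U ⊆? T) (- sg (card U))
        ≡⟨ when-cong (S ⊆? toggle e U ×-dec toggle e U ⊆? T) (S ⊆? U ×-dec U ⊆? T)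
                     (toggle-interval⁻ U) (toggle-interval U) ⟩
      when (S ⊆? U ×-dec U ⊆? T) (- sg (card U))
        ≡⟨ when-neg (S ⊆? U ×-dec U ⊆? T) (sg (card U)) ⟩
      - F U ∎

module StrictOrder (P : FinPoset) where
  open FinPoset P

  _<?_ : ∀ x y → Dec (x < y)
  x <? y = (x ≤? y) ×-dec ¬? (x ≟ y)

  ≤-<-trans : ∀ {x y z} → x ≤ y → y < z → x < z
  ≤-<-trans x≤y (y≤z , y≢z) = ≤-trans x≤y y≤z , λ { refl → y≢z (antisym y≤z x≤y) }

module Alternating (P : FinPoset) (ρ : FinPoset.Carrier P → ℕ) where
  open FinPoset P
  open StrictOrder P

  ∑ᴵ ∑ᴵᴼ : Carrier → Carrier → (Carrier → ℤ) → ℤ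
  ∑ᴵ  x y f = ∑ enum (λ z → when ((x ≤? z) ×-dec (z ≤? y)) (f z))
  ∑ᴵᴼ x y f = ∑ enum (λ z → when ((x ≤? z) ×-dec (z <? y)) (f z))

  module _ {x y : Carrier} where

    #_ : Parity → ℕ
    # p = count (inIntervalOfParity? P (+_ ∘ ρ) x y p)

    #even-#odd : + # even - + # odd ≡ ∑ᴵ x y (λ z → signPow (+ ρ z - + ρ x))
    #even-#odd = begin
      + # even - + # odd
        ≡⟨ cong₂ _-_ (length-filter (E? even) enum) (length-filter (E? odd) enum) ⟩
      ∑ enum fₑ - ∑ enum fₒ
        ≡⟨ cong (λ t → ∑ enum fₑ + t) (∑-neg enum fₒ) ⟨
      ∑ enum fₑ + ∑ enum (λ z → - fₒ z)
        ≡⟨ ∑-distrib-+ enum fₑ (λ z → - fₒ z) ⟨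
      ∑ enum (λ z → fₑ z - fₒ z)
        ≡⟨ ∑-cong enum even-odd ⟩
      ∑ᴵ x y (λ z → signPow (+ ρ z - + ρ x)) ∎
      where
      open ≡-Reasoning
      E? : ∀ p z → Dec (inIntervalOfParity P (+_ ∘ ρ) x y p z)
      E? = inIntervalOfParity? P (+_ ∘ ρ) x y
      fₑ fₒ : Carrier → ℤ
      fₑ z = when (E? even z) 1ℤ
      fₒ z = when (E? odd z) 1ℤ
      even-odd : ∀ z → fₑ z - fₒ z ≡ when ((x ≤? z) ×-dec (z ≤? y)) (signPow (+ ρ z - + ρ x))
      even-odd z with x ≤? z | z ≤? y
      ... | yes _ | yes _ = sym (signPow≡even-odd (+ ρ z - + ρ x))
      ... | yes _ | no _  = refl
      ... | no _  | _     = refl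

    ∑ᴵ-*ˡ : ∀ c f → ∑ᴵ x y (λ z → c * f z) ≡ c * ∑ᴵ x y f
    ∑ᴵ-*ˡ c f = trans (∑-cong enum λ z → when-*ˡ ((x ≤? z) ×-dec (z ≤? y)) c (f z))
                      (∑-distribˡ-* enum c (λ z → when ((x ≤? z) ×-dec (z ≤? y)) (f z)))

    ∑ᴵ-alternating≡0⇒#even≡#odd : ∑ᴵ x y (λ z → signPow (+ ρ z - + ρ x)) ≡ 0ℤ → # even ≡ # odd
    ∑ᴵ-alternating≡0⇒#even≡#odd ∑≡0 = ℤₚ.+-injective (ℤₚ.i-j≡0⇒i≡j _ _ (trans #even-#odd ∑≡0))

    eulerian⇒∑ᴵ-sg≡0 : LocallyEulerian P (+_ ∘ ρ) → x < y → ∑ᴵ x y (sg ∘ ρ) ≡ 0ℤ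
    eulerian⇒∑ᴵ-sg≡0 (_ , balanced) x<y = sg*i≡0⇒i≡0 (ρ x) (begin
      sg (ρ x) * ∑ᴵ x y (sg ∘ ρ)               ≡⟨ ∑ᴵ-*ˡ (sg (ρ x)) (sg ∘ ρ) ⟨
      ∑ᴵ x y (λ z → sg (ρ x) * sg (ρ z))
        ≡⟨ ∑-cong enum (λ z → cong (when ((x ≤? z) ×-dec (z ≤? y))) (sg-diff z)) ⟩
      ∑ᴵ x y (λ z → signPow (+ ρ z - + ρ x))  ≡⟨ #even-#odd ⟨
      + # even - + # odd                       ≡⟨ cong (λ c → + c - + # odd) (balanced x y x<y) ⟩
      + # odd - + # odd                        ≡⟨ ℤₚ.+-inverseʳ (+ # odd) ⟩
      0ℤ                                       ∎)
      where
      open ≡-Reasoning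
      sg-diff : ∀ z → sg (ρ x) * sg (ρ z) ≡ signPow (+ ρ z - + ρ x)
      sg-diff z = trans (ℤₚ.*-comm (sg (ρ x)) _) (sym (signPow-diff (ρ z) (ρ x)))

    ∑ᴵ≡∑ᴵᴼ+top : x ≤ y → ∀ f → ∑ᴵ x y f ≡ ∑ᴵᴼ x y f + f y
    ∑ᴵ≡∑ᴵᴼ+top x≤y f = begin
      ∑ᴵ x y f                                                  ≡⟨ ∑-cong enum split ⟩
      ∑ enum (λ z → when ((x ≤? z) ×-dec (z <? y)) (f z) + δ z) ≡⟨ ∑-distrib-+ enum _ δ ⟩
      ∑ᴵᴼ x y f + ∑ enum δ
        ≡⟨ cong (λ t → ∑ᴵᴼ x y f + t) (∑-δ _≟_ f enum unique (complete y)) ⟩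
      ∑ᴵᴼ x y f + f y                                           ∎
      where
      open ≡-Reasoning
      δ : Carrier → ℤ
      δ z = when (z ≟ y) (f z)
      split : ∀ z → when ((x ≤? z) ×-dec (z ≤? y)) (f z) ≡ when ((x ≤? z) ×-dec (z <? y)) (f z) + δ z
      split z with x ≤? z | z ≤? y | z ≟ y
      ... | yes _   | yes _  | yes _   = sym (ℤₚ.+-identityˡ (f z))
      ... | yes _   | yes _  | no _    = sym (ℤₚ.+-identityʳ (f z))
      ... | _       | no z≰y | yes refl = ⊥-elim (z≰y ≤-refl)
      ... | no x≰z  | _      | yes refl = ⊥-elim (x≰z x≤y)
      ... | yes _   | no _   | no _    = refl
      ... | no _    | _      | no _    = refl

    eulerian⇒∑ᴵᴼ-sg : LocallyEulerian P (+_ ∘ ρ) → x < y → ∑ᴵᴼ x y (sg ∘ ρ) ≡ - sg (ρ y)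
    eulerian⇒∑ᴵᴼ-sg eulerian x<y = ℤₚ.i-j≡0⇒i≡j _ _ (begin
      ∑ᴵᴼ x y (sg ∘ ρ) - - sg (ρ y)
        ≡⟨ cong (λ t → ∑ᴵᴼ x y (sg ∘ ρ) + t) (ℤₚ.neg-involutive (sg (ρ y))) ⟩
      ∑ᴵᴼ x y (sg ∘ ρ) + sg (ρ y)   ≡⟨ ∑ᴵ≡∑ᴵᴼ+top (proj₁ x<y) (sg ∘ ρ) ⟨
      ∑ᴵ x y (sg ∘ ρ)               ≡⟨ eulerian⇒∑ᴵ-sg≡0 eulerian x<y ⟩
      0ℤ                            ∎)
      where open ≡-Reasoning

module Saturated (B : FinOrder n) where
  open FinPoset (toFinPoset B)
  open StrictOrder (toFinPoset B)
  open IsDecPartialOrder (FinOrder.isDecPartialOrder B) using (isPartialOrder)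

  _++ᶜ_ : ∀ {a b c k l} → MaxChain (toFinPoset B) a b k → MaxChain (toFinPoset B) b c l →
          MaxChain (toFinPoset B) a c (k ℕ.+ l)
  done         ++ᶜ b⤳c = b⤳c
  step a⋖z z⤳b ++ᶜ b⤳c = step a⋖z (z⤳b ++ᶜ b⤳c)

  <-wellFounded : WellFounded _<_
  <-wellFounded = po-wellFounded isPartialOrder

  coverBelow : ∀ {s x} → s < x → ∃[ m ] s ≤ m × m ⋖ x
  coverBelow {s} {x} = go (po-noetherian isPartialOrder s)
    where
    go : ∀ {s} → Acc (flip _<_) s → s < x → ∃[ m ] s ≤ m × m ⋖ x
    go {s} (acc above) s<x with any? (λ z → (s <? z) ×-dec (z <? x))
    ... | no ∄z = s , ≤-refl , s<x , λ z s<z z<x → ∄z (z , s<z , z<x)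
    ... | yes (z , s<z , z<x) with go (above s<z) z<x
    ...   | m , z≤m , m⋖x = m , ≤-trans (proj₁ s<z) z≤m , m⋖x

  saturatedChain : ∀ {a b} → a ≤ b → ∃[ k ] MaxChain (toFinPoset B) a b k
  saturatedChain {a} {b} = go (<-wellFounded b)
    where
    go : ∀ {b} → Acc _<_ b → a ≤ b → ∃[ k ] MaxChain (toFinPoset B) a b k
    go {b} (acc below) a≤b with a ≟ b
    ... | yes refl = 0 , done
    ... | no a≢b with coverBelow (a≤b , a≢b)
    ...   | m , a≤m , m⋖b with go (below (proj₁ m⋖b)) a≤m
    ...     | k , a⤳m = k ℕ.+ 1 , a⤳m ++ᶜ step m⋖b done

  module Rank {0̂ : Fin n} (0̂-minimum : IsMinimum 0̂) (ρ : Fin n → ℕ)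
           (ρ-from-0̂ : ∀ x k → MaxChain (toFinPoset B) 0̂ x k → ρ x ≡ k) where

    ρ-MaxChain : ∀ {x y k} → MaxChain (toFinPoset B) x y k → ρ y ≡ ρ x ℕ.+ k
    ρ-MaxChain {x} {y} {k} x⤳y with saturatedChain (0̂-minimum x)
    ... | j , 0̂⤳x =
      trans (ρ-from-0̂ y (j ℕ.+ k) (0̂⤳x ++ᶜ x⤳y)) (cong (ℕ._+ k) (sym (ρ-from-0̂ x j 0̂⤳x)))

    ρ-isRankFunction : IsRankFunction (toFinPoset B) (+_ ∘ ρ)
    ρ-isRankFunction {x} {k = k} x⤳y = trans (cong +_ (ρ-MaxChain x⤳y)) (ℤₚ.pos-+ (ρ x) k)

    ρ-0̂ : ρ 0̂ ≡ 0
    ρ-0̂ = ρ-from-0̂ 0̂ 0 done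

    ρ-⋖ : ∀ {m x} → m ⋖ x → ρ x ≡ suc (ρ m)
    ρ-⋖ m⋖x = trans (ρ-MaxChain (step m⋖x done)) (ℕₚ.+-comm _ 1)

module Barycentric (B : FinOrder n) (0̂ : Fin n) where
  private
    module Γ = FinPoset (Bary B 0̂)

  toBary : ∀ S → IsChainWith0 B 0̂ S → BaryCarrier B 0̂
  toBary S S-chain = S , fromWitness S-chain

  chainWith0 : ∀ c → IsChainWith0 B 0̂ (chain B 0̂ c)
  chainWith0 c = toWitness (proj₂ c)

  IsChain-⊆ : ∀ {S T} → S ⊆ T → IsChain B T → IsChain B S
  IsChain-⊆ S⊆T T-chain i∈S j∈S = T-chain (S⊆T i∈S) (S⊆T j∈S)

  rankˢ : Subset n → ℕ
  rankˢ S = card (S ─ ⁅ 0̂ ⁆)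

  signPow-rankˢ : ∀ {S} → 0̂ ∈ S → ∀ k → signPow (+ rankˢ S - + k) ≡ - sg k * sg (card S)
  signPow-rankˢ {S} 0̂∈S k = begin
    signPow (+ rankˢ S - + k)    ≡⟨ signPow-diff (rankˢ S) k ⟩
    sg (rankˢ S) * sg k          ≡⟨ ℤₚ.*-comm (sg (rankˢ S)) (sg k) ⟩
    sg k * sg (rankˢ S)          ≡⟨ cong (sg k *_) (ℤₚ.neg-involutive _) ⟨
    sg k * - - sg (rankˢ S)      ≡⟨ cong (λ t → sg k * - t) (sg-suc (rankˢ S)) ⟨
    sg k * - sg (suc (rankˢ S))  ≡⟨ ℤₚ.neg-distribʳ-* (sg k) _ ⟨
    - (sg k * sg (suc (rankˢ S))) ≡⟨ ℤₚ.neg-distribˡ-* (sg k) _ ⟩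
    - sg k * sg (suc (rankˢ S))  ≡⟨ cong (λ m → - sg k * sg m) (card-─⁅⁆ 0̂∈S) ⟨
    - sg k * sg (card S)         ∎
    where open ≡-Reasoning

  chain-<⇒⊂ : ∀ {c d} → c Γ.< d → chain B 0̂ c ⊂ chain B 0̂ d
  chain-<⇒⊂ (c⊆d , c≢d) = ⊆∧≢⇒⊂ c⊆d (c≢d ∘ Sub-≡ (IsChainWith0? B 0̂))

  card-⋖ : ∀ {c d} → c Γ.⋖ d → card (chain B 0̂ d) ≡ suc (card (chain B 0̂ c))
  card-⋖ {c} {d} (c<d , nothing-between) with chain-<⇒⊂ c<d
  ... | c⊆d , e , e∈d , e∉c =
    trans (cong (card ∘ chain B 0̂) (sym c+e≡d)) (card-toggle-∉ e∉c)
    where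
    c+e : BaryCarrier B 0̂
    c+e = toBary (toggle e (chain B 0̂ c))
            ( y∈toggle (λ { refl → e∉c (proj₁ (chainWith0 c)) }) (proj₁ (chainWith0 c))
            , IsChain-⊆ (toggle-⊆ e∈d c⊆d) (proj₂ (chainWith0 d)))
    c<c+e : c Γ.< c+e
    c<c+e = ⊆-toggle e∉c (λ j∈c → j∈c) ,
            λ c≡c+e → e∉c (subst (λ c → e ∈ chain B 0̂ c) (sym c≡c+e) (x∈toggle e∉c))
    c+e≡d : c+e ≡ d
    c+e≡d = decidable-stable (c+e Γ.≟ d) λ c+e≢d → nothing-between c+e c<c+e (toggle-⊆ e∈d c⊆d , c+e≢d)

  rank-⋖ : ∀ {c d} → c Γ.⋖ d → rankBary B 0̂ d ≡ suc (rankBary B 0̂ c)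
  rank-⋖ {c} {d} c⋖d = ℕₚ.suc-injective (begin
    suc (rankBary B 0̂ d)       ≡⟨ card-─⁅⁆ (proj₁ (chainWith0 d)) ⟨
    card (chain B 0̂ d)         ≡⟨ card-⋖ c⋖d ⟩
    suc (card (chain B 0̂ c))   ≡⟨ cong suc (card-─⁅⁆ (proj₁ (chainWith0 c))) ⟩
    suc (suc (rankBary B 0̂ c)) ∎)
    where open ≡-Reasoning

  rank-MaxChain : ∀ {c d k} → MaxChain (Bary B 0̂) c d k → rankBary B 0̂ d ≡ rankBary B 0̂ c ℕ.+ k
  rank-MaxChain {c} done = sym (ℕₚ.+-identityʳ (rankBary B 0̂ c))
  rank-MaxChain {c} {k = suc k} (step c⋖z z⤳d) =
    trans (rank-MaxChain z⤳d) (trans (cong (ℕ._+ k) (rank-⋖ c⋖z)) (sym (ℕₚ.+-suc (rankBary B 0̂ c) k)))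

  locallyGraded : LocallyGraded (Bary B 0̂)
  locallyGraded {c} c⤳d c⤳d′ =
    ℕₚ.+-cancelˡ-≡ (rankBary B 0̂ c) _ _ (trans (sym (rank-MaxChain c⤳d)) (rank-MaxChain c⤳d′))

  rank-isRankFunction : IsRankFunction (Bary B 0̂) (+_ ∘ rankBary B 0̂)
  rank-isRankFunction {c} {k = k} c⤳d = trans (cong +_ (rank-MaxChain c⤳d)) (ℤₚ.pos-+ (rankBary B 0̂ c) k)

  open Alternating (Bary B 0̂) (rankBary B 0̂)

  ∑ᴵ-alternating≡0 : ∀ {c c′} → c Γ.< c′ →
                     ∑ᴵ c c′ (λ z → signPow (+ rankBary B 0̂ z - + rankBary B 0̂ c)) ≡ 0ℤ
  ∑ᴵ-alternating≡0 {c} {c′} c<c′ with chain-<⇒⊂ c<c′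
  ... | _ , e , e∈c′ , e∉c = begin
    ∑ᴵ c c′ (λ z → signPow (+ rankBary B 0̂ z - + r))
      ≡⟨ ∑-subList (IsChainWith0? B 0̂) _ f (λ _ _ → refl) outside-chains (allSubsets n) ⟩
    ∑ (allSubsets n) f
      ≡⟨ ∑-cong (allSubsets n) signs ⟩
    ∑ (allSubsets n) (λ U → - sg r * when (I? U) (sg (card U)))
      ≡⟨ ∑-distribˡ-* (allSubsets n) (- sg r) _ ⟩
    - sg r * ∑ (allSubsets n) (λ U → when (I? U) (sg (card U)))
      ≡⟨ cong (- sg r *_) (∑-sg-card-interval e∉c e∈c′) ⟩
    - sg r * 0ℤ
      ≡⟨ ℤₚ.*-zeroʳ (- sg r) ⟩
    0ℤ ∎
    where
    open ≡-Reasoning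
    r : ℕ
    r = rankBary B 0̂ c
    I? : ∀ U → Dec (chain B 0̂ c ⊆ U × U ⊆ chain B 0̂ c′)
    I? U = (chain B 0̂ c ⊆? U) ×-dec (U ⊆? chain B 0̂ c′)
    f : Subset n → ℤ
    f U = when (I? U) (signPow (+ rankˢ U - + r))
    outside-chains : ∀ U → ¬ IsChainWith0 B 0̂ U → f U ≡ 0ℤ
    outside-chains U ¬chain = when-no (I? U) λ (c⊆U , U⊆c′) →
      ¬chain (c⊆U (proj₁ (chainWith0 c)) , IsChain-⊆ U⊆c′ (proj₂ (chainWith0 c′)))
    signs : ∀ U → f U ≡ - sg r * when (I? U) (sg (card U))
    signs U = trans (when-congʳ (I? U) (λ (c⊆U , _) → signPow-rankˢ (c⊆U (proj₁ (chainWith0 c))) r))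
                    (when-*ˡ (I? U) (- sg r) (sg (card U)))

  rank-locallyEulerian : LocallyEulerian (Bary B 0̂) (+_ ∘ rankBary B 0̂)
  rank-locallyEulerian =
    locallyGraded , λ c c′ c<c′ → ∑ᴵ-alternating≡0⇒#even≡#odd {c} {c′} (∑ᴵ-alternating≡0 c<c′)

  ⁅0̂⁆ᴮ : BaryCarrier B 0̂
  ⁅0̂⁆ᴮ = toBary ⁅ 0̂ ⁆
    (x∈⁅x⁆ 0̂ , λ i∈ j∈ → inj₁ (reflexive (trans (x∈⁅y⁆⇒x≡y 0̂ i∈) (sym (x∈⁅y⁆⇒x≡y 0̂ j∈)))))
    where open FinPoset (toFinPoset B) using (reflexive)

  ⁅0̂⁆ᴮ-minimum : Γ.IsMinimum ⁅0̂⁆ᴮ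
  ⁅0̂⁆ᴮ-minimum c j∈⁅0̂⁆ =
    subst (_∈ chain B 0̂ c) (sym (x∈⁅y⁆⇒x≡y 0̂ j∈⁅0̂⁆)) (proj₁ (chainWith0 c))

  rank-minimum : ∀ {c} → Γ.IsMinimum c → rankBary B 0̂ c ≡ 0
  rank-minimum {c} c-minimum = ℕₚ.suc-injective (begin
    suc (rankBary B 0̂ c) ≡⟨ card-─⁅⁆ (proj₁ (chainWith0 c)) ⟨
    card (chain B 0̂ c)   ≡⟨ cong card (⊆-antisym (c-minimum ⁅0̂⁆ᴮ) (⁅0̂⁆ᴮ-minimum c)) ⟩
    card ⁅ 0̂ ⁆           ≡⟨ ∣⁅x⁆∣≡1 0̂ ⟩
    1                    ∎)
    where open ≡-Reasoning

module Subdivision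
  (B : FinOrder n) (0̂ : Fin n) (0̂-minimum : FinPoset.IsMinimum (toFinPoset B) 0̂)
  (ρ : Fin n → ℕ) (ρ-from-0̂ : ∀ x k → MaxChain (toFinPoset B) 0̂ x k → ρ x ≡ k)
  (B-eulerian : LocallyEulerian (toFinPoset B) (+_ ∘ ρ))
  (σ : BaryCarrier B 0̂ → Fin n)
  (σ-top : ∀ c → σ c ∈ chain B 0̂ c × (∀ {j} → j ∈ chain B 0̂ c → FinOrder._≤_ B j (σ c)))
  where

  open FinPoset (toFinPoset B)
  open StrictOrder (toFinPoset B)
  open Saturated B
  open Saturated.Rank B 0̂-minimum ρ ρ-from-0̂
  open Barycentric B 0̂ using (toBary; chainWith0; IsChain-⊆; ⁅0̂⁆ᴮ; rankˢ; signPow-rankˢ)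
  open Alternating (toFinPoset B) ρ using (∑ᴵᴼ; eulerian⇒∑ᴵᴼ-sg)
  private
    module Γ = FinPoset (Bary B 0̂)

  σ-unique : ∀ c {x} → x ∈ chain B 0̂ c → (∀ {j} → j ∈ chain B 0̂ c → j ≤ x) → σ c ≡ x
  σ-unique c x∈c c≤x = antisym (c≤x (proj₁ (σ-top c))) (proj₂ (σ-top c) x∈c)

  TopExtension : Fin n → Subset n → Subset n → Set
  TopExtension x C S = IsChainWith0 B 0̂ S × C ⊆ S × x ∈ S × (∀ {j} → j ∈ S → j ≤ x)

  TopExtension? : ∀ x C S → Dec (TopExtension x C S)
  TopExtension? x C S = IsChainWith0? B 0̂ S ×-dec (C ⊆? S) ×-dec (x ∈? S) ×-dec
                        decFinSubset (_∈? S) (λ {j} _ → j ≤? x)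

  ExtensionBelow : Fin n → Subset n → Subset n → Set
  ExtensionBelow x C S = IsChainWith0 B 0̂ S × C ⊆ S × (∀ {j} → j ∈ S → j < x)

  ExtensionBelow? : ∀ x C S → Dec (ExtensionBelow x C S)
  ExtensionBelow? x C S = IsChainWith0? B 0̂ S ×-dec (C ⊆? S) ×-dec
                          decFinSubset (_∈? S) (λ {j} _ → j <? x)

  module _ {x : Fin n} (x≢0̂ : x ≢ 0̂) {C : Subset n} where

    toggle-extensionBelow : ∀ S → ExtensionBelow x (C ─ ⁅ x ⁆) S → TopExtension x C (toggle x S)
    toggle-extensionBelow S ((0̂∈S , S-chain) , C-x⊆S , S<x) =
      (y∈toggle (x≢0̂ ∘ sym) 0̂∈S , tS-chain) , C⊆tS , x∈toggle x∉S , tS≤x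
      where
      x∉S : x ∉ S
      x∉S x∈S = proj₂ (S<x x∈S) refl
      tS≤x : ∀ {j} → j ∈ toggle x S → j ≤ x
      tS≤x j∈tS with ∈toggle⇒≡⊎∈ j∈tS
      ... | inj₁ refl = ≤-refl
      ... | inj₂ j∈S  = proj₁ (S<x j∈S)
      tS-chain : IsChain B (toggle x S)
      tS-chain i∈tS j∈tS with ∈toggle⇒≡⊎∈ i∈tS | ∈toggle⇒≡⊎∈ j∈tS
      ... | inj₁ refl | _         = inj₂ (tS≤x j∈tS)
      ... | inj₂ _    | inj₁ refl = inj₁ (tS≤x i∈tS)
      ... | inj₂ i∈S  | inj₂ j∈S  = S-chain i∈S j∈S
      C⊆tS : C ⊆ toggle x S
      C⊆tS {j} j∈C with j ≟ x
      ... | yes refl = x∈toggle x∉S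
      ... | no j≢x   = y∈toggle j≢x (C-x⊆S (x∈p∧x≢y⇒x∈p-y j∈C j≢x))

    toggle-extensionBelow⁻ : ∀ S → TopExtension x C (toggle x S) → ExtensionBelow x (C ─ ⁅ x ⁆) S
    toggle-extensionBelow⁻ S ((0̂∈tS , tS-chain) , C⊆tS , x∈tS , tS≤x) =
      (y∈toggle⁻ (x≢0̂ ∘ sym) 0̂∈tS , IsChain-⊆ S⊆tS tS-chain) , C-x⊆S ,
      λ j∈S → tS≤x (S⊆tS j∈S) , S≢x j∈S
      where
      S≢x : ∀ {j} → j ∈ S → j ≢ x
      S≢x j∈S refl = x∉toggle j∈S x∈tS
      S⊆tS : S ⊆ toggle x S
      S⊆tS j∈S = y∈toggle (S≢x j∈S) j∈S
      C-x⊆S : C ─ ⁅ x ⁆ ⊆ S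
      C-x⊆S j∈C-x = y∈toggle⁻ (∈─⁅x⁆⇒≢x j∈C-x) (C⊆tS (p─q⊆p C ⁅ x ⁆ j∈C-x))

  extensionBelow-by-top : ∀ x C S v →
    when (ExtensionBelow? x C S) v ≡ ∑ enum (λ m → when (m <? x) (when (TopExtension? m C S) v))
  extensionBelow-by-top x C S v = when-≡ (ExtensionBelow? x C S) single-top no-top
    where
    below? : ∀ m → Dec (m < x × TopExtension m C S)
    below? m = (m <? x) ×-dec TopExtension? m C S
    single-top : ExtensionBelow x C S → v ≡ ∑ enum (λ m → when (m <? x) (when (TopExtension? m C S) v))
    single-top (S-chain , C⊆S , S<x) = sym (begin
      ∑ enum (λ m → when (m <? x) (when (TopExtension? m C S) v))
        ≡⟨ ∑-cong enum (λ m → when-× (m <? x) (TopExtension? m C S) v) ⟨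
      ∑ enum (λ m → when (below? m) v)
        ≡⟨ ∑-cong enum (λ m → when-cong (below? m) (m ≟ t) is-top is-top⁻) ⟩
      ∑ enum (λ m → when (m ≟ t) v)
        ≡⟨ ∑-δ _≟_ (λ _ → v) enum unique (complete t) ⟩
      v ∎)
      where
      open ≡-Reasoning
      b : BaryCarrier B 0̂
      b = toBary S S-chain
      t : Fin n
      t = σ b
      is-top : ∀ {m} → m < x × TopExtension m C S → m ≡ t
      is-top (_ , _ , _ , m∈S , S≤m) = sym (σ-unique b m∈S S≤m)
      is-top⁻ : ∀ {m} → m ≡ t → m < x × TopExtension m C S
      is-top⁻ refl = S<x (proj₁ (σ-top b)) , S-chain , C⊆S , σ-top b
    no-top : ¬ ExtensionBelow x C S → 0ℤ ≡ ∑ enum (λ m → when (m <? x) (when (TopExtension? m C S) v))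
    no-top ¬below = sym (trans (∑-cong enum not-below) (∑-zero enum))
      where
      not-below : ∀ m → when (m <? x) (when (TopExtension? m C S) v) ≡ 0ℤ
      not-below m = trans (sym (when-× (m <? x) (TopExtension? m C S) v)) (when-no (below? m)
        λ (m<x , S-chain , C⊆S , _ , S≤m) → ¬below (S-chain , C⊆S , λ j∈S → ≤-<-trans (S≤m j∈S) m<x))

  χ : Fin n → BaryCarrier B 0̂ → ℤ
  χ x c = ∑ (allSubsets n) (λ S → when (TopExtension? x (chain B 0̂ c) S) (sg (card S)))

  module _ (c : BaryCarrier B 0̂) (σc≤0̂ : σ c ≤ 0̂) where

    ≤0̂⇒≡0̂ : ∀ {j} → j ≤ 0̂ → j ≡ 0̂
    ≤0̂⇒≡0̂ j≤0̂ = antisym j≤0̂ (0̂-minimum _)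

    ⁅0̂⁆-topExtension : TopExtension 0̂ (chain B 0̂ c) ⁅ 0̂ ⁆
    ⁅0̂⁆-topExtension =
      chainWith0 ⁅0̂⁆ᴮ ,
      (λ j∈c → subst (_∈ ⁅ 0̂ ⁆) (sym (≤0̂⇒≡0̂ (≤-trans (proj₂ (σ-top c) j∈c) σc≤0̂)))
                     (x∈⁅x⁆ 0̂)) ,
      x∈⁅x⁆ 0̂ ,
      λ j∈⁅0̂⁆ → reflexive (x∈⁅y⁆⇒x≡y 0̂ j∈⁅0̂⁆)

    topExtension-0̂ : ∀ S → TopExtension 0̂ (chain B 0̂ c) S → S ≡ ⁅ 0̂ ⁆
    topExtension-0̂ S ((0̂∈S , _) , _ , _ , S≤0̂) = ⊆-antisym
      (λ j∈S → subst (_∈ ⁅ 0̂ ⁆) (sym (≤0̂⇒≡0̂ (S≤0̂ j∈S))) (x∈⁅x⁆ 0̂))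
      (λ j∈⁅0̂⁆ → subst (_∈ S) (sym (x∈⁅y⁆⇒x≡y 0̂ j∈⁅0̂⁆)) 0̂∈S)

    χ-0̂ : χ 0̂ c ≡ - sg (ρ 0̂)
    χ-0̂ = begin
      χ 0̂ c
        ≡⟨ ∑-cong (allSubsets n) (λ S → when-cong (TopExtension? 0̂ (chain B 0̂ c) S) (S ≟ˢ ⁅ 0̂ ⁆)
                                          (topExtension-0̂ S) λ { refl → ⁅0̂⁆-topExtension }) ⟩
      ∑ (allSubsets n) (λ S → when (S ≟ˢ ⁅ 0̂ ⁆) (sg (card S)))
        ≡⟨ ∑-δ _≟ˢ_ (sg ∘ card) (allSubsets n) (allSubsets-unique n) (allSubsets-complete ⁅ 0̂ ⁆) ⟩
      sg (card ⁅ 0̂ ⁆)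
        ≡⟨ cong sg (∣⁅x⁆∣≡1 0̂) ⟩
      - sg 0
        ≡⟨ cong (-_ ∘ sg) ρ-0̂ ⟨
      - sg (ρ 0̂) ∎
      where
      open ≡-Reasoning
      _≟ˢ_ : DecidableEquality (Subset n)
      _≟ˢ_ = ≡-dec Bool._≟_

  module Peel {x : Fin n} (x≢0̂ : x ≢ 0̂) (c : BaryCarrier B 0̂) (σc≤x : σ c ≤ x) where

    c⁻ : BaryCarrier B 0̂
    c⁻ = toBary (chain B 0̂ c ─ ⁅ x ⁆)
           ( x∈p∧x≢y⇒x∈p-y (proj₁ (chainWith0 c)) (x≢0̂ ∘ sym)
           , IsChain-⊆ (p─q⊆p _ ⁅ x ⁆) (proj₂ (chainWith0 c)))

    σc⁻<x : σ c⁻ < x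
    σc⁻<x = ≤-trans (proj₂ (σ-top c) (p─q⊆p _ ⁅ x ⁆ σc⁻∈c⁻)) σc≤x , ∈─⁅x⁆⇒≢x σc⁻∈c⁻
      where
      σc⁻∈c⁻ : σ c⁻ ∈ chain B 0̂ c⁻
      σc⁻∈c⁻ = proj₁ (σ-top c⁻)

    χ-toggle : χ x c ≡ - ∑ (allSubsets n) (λ S → when (ExtensionBelow? x (chain B 0̂ c⁻) S) (sg (card S)))
    χ-toggle = begin
      χ x c                                                   ≡⟨ ∑-toggle x F ⟨
      ∑ (allSubsets n) (F ∘ toggle x)                          ≡⟨ ∑-cong (allSubsets n) F∘toggle ⟩
      ∑ (allSubsets n) (λ S → - when (EB? S) (sg (card S)))    ≡⟨ ∑-neg (allSubsets n) _ ⟩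
      - ∑ (allSubsets n) (λ S → when (EB? S) (sg (card S)))    ∎
      where
      open ≡-Reasoning
      EB? : ∀ S → Dec (ExtensionBelow x (chain B 0̂ c⁻) S)
      EB? = ExtensionBelow? x (chain B 0̂ c⁻)
      F : Subset n → ℤ
      F S = when (TopExtension? x (chain B 0̂ c) S) (sg (card S))
      F∘toggle : ∀ S → F (toggle x S) ≡ - when (EB? S) (sg (card S))
      F∘toggle S = begin
        F (toggle x S)
          ≡⟨ cong (when (TopExtension? x (chain B 0̂ c) (toggle x S))) (sg-card-toggle x S) ⟩
        when (TopExtension? x (chain B 0̂ c) (toggle x S)) (- sg (card S))
          ≡⟨ when-cong (TopExtension? x (chain B 0̂ c) (toggle x S)) (EB? S)
                       (toggle-extensionBelow⁻ x≢0̂ S) (toggle-extensionBelow x≢0̂ S) ⟩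
        when (EB? S) (- sg (card S))
          ≡⟨ when-neg (EB? S) (sg (card S)) ⟩
        - when (EB? S) (sg (card S)) ∎

  χ≡-sg : ∀ {x} → Acc _<_ x → ∀ c → σ c ≤ x → χ x c ≡ - sg (ρ x)
  χ≡-sg {x} (acc below) c σc≤x with x ≟ 0̂
  ... | yes refl = χ-0̂ c σc≤x
  ... | no x≢0̂   = begin
    χ x c
      ≡⟨ χ-toggle ⟩
    - ∑ (allSubsets n) (λ S → when (ExtensionBelow? x C⁻ S) (sg (card S)))
      ≡⟨ cong -_ (∑-cong (allSubsets n) λ S → extensionBelow-by-top x C⁻ S (sg (card S))) ⟩
    - ∑ (allSubsets n) (λ S → ∑ enum (λ m → when (m <? x) (when (TopExtension? m C⁻ S) (sg (card S)))))
      ≡⟨ cong -_ (∑-comm (allSubsets n) enum _) ⟩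
    - ∑ enum (λ m → ∑ (allSubsets n) (λ S → when (m <? x) (when (TopExtension? m C⁻ S) (sg (card S)))))
      ≡⟨ cong -_ (∑-cong enum λ m → ∑-when (m <? x) (allSubsets n) _) ⟩
    - ∑ enum (λ m → when (m <? x) (χ m c⁻))
      ≡⟨ cong -_ (∑-cong enum by-induction) ⟩
    - ∑ᴵᴼ s x (λ m → - sg (ρ m))
      ≡⟨ cong -_ (trans (∑-cong enum λ m → when-neg ((s ≤? m) ×-dec (m <? x)) (sg (ρ m))) (∑-neg enum _)) ⟩
    - - ∑ᴵᴼ s x (sg ∘ ρ)
      ≡⟨ ℤₚ.neg-involutive _ ⟩
    ∑ᴵᴼ s x (sg ∘ ρ)
      ≡⟨ eulerian⇒∑ᴵᴼ-sg B-eulerian σc⁻<x ⟩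
    - sg (ρ x) ∎
    where
    open ≡-Reasoning
    open Peel x≢0̂ c σc≤x
    C⁻ : Subset n
    C⁻ = chain B 0̂ c⁻
    s : Fin n
    s = σ c⁻
    by-induction : ∀ m → when (m <? x) (χ m c⁻) ≡ when ((s ≤? m) ×-dec (m <? x)) (- sg (ρ m))
    by-induction m with s ≤? m
    ... | yes s≤m = when-congʳ (m <? x) (λ m<x → χ≡-sg (below m<x) c⁻ s≤m)
    ... | no s≰m  = trans (cong (when (m <? x)) no-extensions) (when-0 (m <? x))
      where
      no-extensions : χ m c⁻ ≡ 0ℤ
      no-extensions = trans (∑-cong (allSubsets n) λ S → when-no (TopExtension? m C⁻ S)
                              λ (_ , C⁻⊆S , _ , S≤m) → s≰m (S≤m (C⁻⊆S (proj₁ (σ-top c⁻)))))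
                            (∑-zero (allSubsets n))

  topExtension-exists : ∀ {x} → Acc _<_ x → ∀ c → σ c ≤ x →
                        ∃[ S ] TopExtension x (chain B 0̂ c) S × card S ≡ suc (ρ x)
  topExtension-exists {x} (acc below) c σc≤x with x ≟ 0̂
  ... | yes refl = ⁅ 0̂ ⁆ , ⁅0̂⁆-topExtension c σc≤x , trans (∣⁅x⁆∣≡1 0̂) (cong suc (sym ρ-0̂))
  ... | no x≢0̂ with coverBelow (Peel.σc⁻<x x≢0̂ c σc≤x)
  ...   | m , s≤m , m⋖x with topExtension-exists (below (proj₁ m⋖x)) (Peel.c⁻ x≢0̂ c σc≤x) s≤m
  ...     | S , (S-chain , C⁻⊆S , _ , S≤m) , ∣S∣≡1+ρm =
    toggle x S , toggle-extensionBelow x≢0̂ S (S-chain , C⁻⊆S , S<x) ,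
    trans (card-toggle-∉ λ x∈S → proj₂ (S<x x∈S) refl) (cong suc (trans ∣S∣≡1+ρm (sym (ρ-⋖ m⋖x))))
    where
    S<x : ∀ {j} → j ∈ S → j < x
    S<x j∈S = ≤-<-trans (S≤m j∈S) (proj₁ m⋖x)

  fiber-exists : ∀ y x → σ y ≤ x →
                 ∃[ y′ ] (y Γ.≤ y′ × σ y′ ≡ x × + rankBary B 0̂ y′ ≡ + ρ x)
  fiber-exists y x σy≤x with topExtension-exists (<-wellFounded x) y σy≤x
  ... | S , (S-chain , y⊆S , x∈S , S≤x) , ∣S∣≡1+ρx =
    toBary S S-chain , y⊆S , σ-unique (toBary S S-chain) x∈S S≤x ,
    cong +_ (ℕₚ.suc-injective (trans (sym (card-─⁅⁆ (proj₁ S-chain))) ∣S∣≡1+ρx))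

  fiber-sum : ∀ y x → σ y ≤ x →
    Γ.sumWhere (fiberAbove? (Bary B 0̂) (toFinPoset B) (+_ ∘ rankBary B 0̂) (+_ ∘ ρ) σ y x)
               (λ y′ → signPow (+ ρ x - + rankBary B 0̂ y′)) ≡ 1ℤ
  fiber-sum y x σy≤x = begin
    Γ.sumWhere fiber? f
      ≡⟨ ∑-filter fiber? Γ.enum f ⟩
    ∑ Γ.enum (λ y′ → when (fiber? y′) (f y′))
      ≡⟨ ∑-subList (IsChainWith0? B 0̂) _ g in-fiber outside-chains (allSubsets n) ⟩
    ∑ (allSubsets n) g
      ≡⟨ ∑-cong (allSubsets n) (λ S → when-*ˡ (TE? S) (- sg (ρ x)) (sg (card S))) ⟩
    ∑ (allSubsets n) (λ S → - sg (ρ x) * when (TE? S) (sg (card S)))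
      ≡⟨ ∑-distribˡ-* (allSubsets n) (- sg (ρ x)) _ ⟩
    - sg (ρ x) * χ x y
      ≡⟨ cong (- sg (ρ x) *_) (χ≡-sg (<-wellFounded x) y σy≤x) ⟩
    - sg (ρ x) * - sg (ρ x)
      ≡⟨ ℤₚ.neg-distribˡ-* (sg (ρ x)) _ ⟨
    - (sg (ρ x) * - sg (ρ x))
      ≡⟨ cong -_ (ℤₚ.neg-distribʳ-* (sg (ρ x)) _) ⟨
    - - (sg (ρ x) * sg (ρ x))
      ≡⟨ ℤₚ.neg-involutive _ ⟩
    sg (ρ x) * sg (ρ x)
      ≡⟨ sg*sg≡1 (ρ x) ⟩
    1ℤ ∎
    where
    open ≡-Reasoning
    fiber? : ∀ y′ → Dec (y Γ.≤ y′ × σ y′ ≡ x)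
    fiber? = fiberAbove? (Bary B 0̂) (toFinPoset B) (+_ ∘ rankBary B 0̂) (+_ ∘ ρ) σ y x
    f : BaryCarrier B 0̂ → ℤ
    f y′ = signPow (+ ρ x - + rankBary B 0̂ y′)
    TE? : ∀ S → Dec (TopExtension x (chain B 0̂ y) S)
    TE? = TopExtension? x (chain B 0̂ y)
    g : Subset n → ℤ
    g S = when (TE? S) (- sg (ρ x) * sg (card S))
    in-fiber : ∀ S (S-chain : IsChainWith0 B 0̂ S) → when (fiber? (toBary S S-chain)) (f (toBary S S-chain)) ≡ g S
    in-fiber S S-chain = trans
      (cong (when (fiber? b)) (trans (signPow-diff-comm (ρ x) (rankˢ S)) (signPow-rankˢ (proj₁ S-chain) (ρ x))))
      (when-cong (fiber? b) (TE? S)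
        (λ (y⊆S , σb≡x) → S-chain , y⊆S , subst (_∈ S) σb≡x (proj₁ (σ-top b)) ,
                           λ j∈S → subst (_ ≤_) σb≡x (proj₂ (σ-top b) j∈S))
        (λ (_ , y⊆S , x∈S , S≤x) → y⊆S , σ-unique b x∈S S≤x))
      where
      b : BaryCarrier B 0̂
      b = toBary S S-chain
    outside-chains : ∀ S → ¬ IsChainWith0 B 0̂ S → g S ≡ 0ℤ
    outside-chains S ¬chain = when-no (TE? S) (¬chain ∘ proj₁)

  σ-monotone : ∀ y y′ → y Γ.≤ y′ → σ y ≤ σ y′
  σ-monotone y y′ y⊆y′ = proj₂ (σ-top y′) (y⊆y′ (proj₁ (σ-top y)))

  rank≤ρ∘σ : ∀ y → + rankBary B 0̂ y ≤ℤ + ρ (σ y)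
  rank≤ρ∘σ y with topExtension-exists (<-wellFounded (σ y)) y ≤-refl
  ... | S , (_ , y⊆S , _) , ∣S∣≡1+ρσy = ℤ.+≤+ (ℕₚ.≤-pred (begin
    suc (rankBary B 0̂ y) ≡⟨ card-─⁅⁆ (proj₁ (chainWith0 y)) ⟨
    card (chain B 0̂ y)   ≤⟨ p⊆q⇒∣p∣≤∣q∣ y⊆S ⟩
    card S               ≡⟨ ∣S∣≡1+ρσy ⟩
    suc (ρ (σ y))        ∎))
    where open ℕₚ.≤-Reasoning

  σ-surjective : ∀ x → ∃[ y ] σ y ≡ x
  σ-surjective x
    with fiber-exists ⁅0̂⁆ᴮ x (subst (_≤ x) (sym (x∈⁅y⁆⇒x≡y 0̂ (proj₁ (σ-top ⁅0̂⁆ᴮ)))) (0̂-minimum x))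
  ... | y , _ , σy≡x , _ = y , σy≡x

  rank-difference≡0 : ∀ 0Γ 0B → Γ.IsMinimum 0Γ → IsMinimum 0B → + ρ 0B - + rankBary B 0̂ 0Γ ≡ 0ℤ
  rank-difference≡0 0Γ 0B 0Γ-minimum 0B-minimum =
    cong₂ (λ a b → + a - + b) (trans (cong ρ (antisym (0B-minimum 0̂) (0̂-minimum 0B))) ρ-0̂)
                              (Barycentric.rank-minimum B 0̂ {0Γ} 0Γ-minimum)

lemma3p23 : ∀ {n : ℕ} (B : FinOrder n) (0̂ : Fin n) (ρB : Fin n → ℕ)
    → LocallyEulerian (toFinPoset B) (λ x → + ρB x)
    → FinPoset.IsMinimum (toFinPoset B) 0̂
    → (∀ x k → MaxChain (toFinPoset B) 0̂ x k → ρB x ≡ k)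
    → (σ : BaryCarrier B 0̂ → Fin n)
    → (∀ c → σ c ∈ chain B 0̂ c × (∀ {j} → j ∈ chain B 0̂ c → FinOrder._≤_ B j (σ c)))
    → IsStrongFormalSubdivisionOfRank (Bary B 0̂) (toFinPoset B)
        (λ c → + rankBary B 0̂ c) (λ x → + ρB x) σ (+ 0)
lemma3p23 B 0̂ ρB B-eulerian 0̂-minimum ρB-from-0̂ σ σ-top =
  ( (rank-locallyEulerian , rank-isRankFunction)
  , (B-eulerian , ρ-isRankFunction)
  , σ-monotone , rank≤ρ∘σ , σ-surjective
  , λ y x σy≤x → fiber-exists y x σy≤x , fiber-sum y x σy≤x )
  , (rank-locallyEulerian , ⁅0̂⁆ᴮ , ⁅0̂⁆ᴮ-minimum)
  , (B-eulerian , 0̂ , 0̂-minimum)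
  , rank-difference≡0
  where
  open Barycentric B 0̂
  open Saturated.Rank B 0̂-minimum ρB ρB-from-0̂
  open Subdivision B 0̂ 0̂-minimum ρB ρB-from-0̂ B-eulerian σ σ-top
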